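{- Let $\omega=t_1\pi_1+\dots+t_m\pi_m$ be a formal real linear combination of $k$-permutations. If $\sum_{i\in[m]}t_iP_{\pi_i}=0$, then the cover matrix $C(\omega)$ is constant (all its entries are equal).
   Context: $[k]=\{1,\dots,k\}$; a $k$-permutation is a bijection $\pi:[k]\to[k]$. Its permutation matrix $A_\pi\in\mathbb{R}^{k\times k}$ has $(A_\pi)_{i,j}=1$ if $\pi(i)=j$, else $0$. The cover matrix of $\omega=\sum_i t_i\pi_i$ is $C(\omega)=\sum_i t_iA_{\pi_i}$. The gradient polynomial of a $k$-permutation $\pi$ is $P_\pi(\alpha,\beta)=k!\sum_{m\in[k]}\left(\frac{k-m}{1-\alpha}-\frac{m-1}{\alpha}\right)\left(\frac{k-\pi(m)}{1-\beta}-\frac{\pi(m)-1}{\beta}\right)\frac{\alpha^{m-1}(1-\alpha)^{k-m}\beta^{\pi(m)-1}(1-\beta)^{k-\pi(m)}}{(m-1)!(k-m)!(\pi(m)-1)!(k-\pi(m))!}$, a polynomial in $\alpha,\beta$. -}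

module Defs where

open import Level using (Level)
open import Data.Nat as ℕ using (ℕ; zero; suc; _∸_; _!)
open import Data.Nat.Properties using (_!*_!≢0)
open import Data.Integer using (+_)
open import Data.Fin using (Fin; toℕ; _≟_)
open import Data.Fin.Permutation using (Permutation′; _⟨$⟩ʳ_)
open import Data.List using (List; []; _∷_)
open import Data.Rational as ℚ using (ℚ; 0ℚ; 1ℚ; _/_)
open import Data.Rational.Properties using (+-*-rawRing)
open import Algebra.Bundles using (CommutativeRing)
open import Algebra.Morphism.Structures using (IsRingHomomorphism)
open import Relation.Nullary using (yes; no)

-- Univariate polynomials over ℚ as coefficient lists (constant term first)

Poly : Set
Poly = List ℚ

infixl 6 _+ₚ_
infixl 7 _*ₚ_ _·ₚ_

_+ₚ_ : Poly → Poly → Poly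
[]       +ₚ q        = q
(a ∷ p)  +ₚ []       = a ∷ p
(a ∷ p)  +ₚ (b ∷ q)  = (a ℚ.+ b) ∷ (p +ₚ q)

_·ₚ_ : ℚ → Poly → Poly
c ·ₚ []      = []
c ·ₚ (a ∷ p) = (c ℚ.* a) ∷ (c ·ₚ p)

_*ₚ_ : Poly → Poly → Poly
[]      *ₚ q = []
(a ∷ p) *ₚ q = (a ·ₚ q) +ₚ (0ℚ ∷ (p *ₚ q))

Xₚ : Poly
Xₚ = 0ℚ ∷ 1ℚ ∷ []

oneMinusXₚ : Poly
oneMinusXₚ = 1ℚ ∷ ℚ.- 1ℚ ∷ []

_^ₚ_ : Poly → ℕ → Poly
p ^ₚ zero  = 1ℚ ∷ []
p ^ₚ suc n = p *ₚ (p ^ₚ n)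

coeff : Poly → ℕ → ℚ
coeff []      _       = 0ℚ
coeff (a ∷ p) zero    = a
coeff (a ∷ p) (suc n) = coeff p n

-- Factor of the gradient polynomial for index m ∈ [k] (m = toℕ i + 1):
--   ((k-m)/(1-x) - (m-1)/x) * x^(m-1) (1-x)^(k-m) / ((m-1)! (k-m)!)
-- = [ (k-m) x^(m-1) (1-x)^(k-m-1) - (m-1) x^(m-2) (1-x)^(k-m) ] / ((m-1)! (k-m)!)
-- (a term whose numerical coefficient k-m resp. m-1 is 0 vanishes,
--  so truncated subtraction in the exponent is harmless).

gradFactor : (k : ℕ) → Fin k → Poly
gradFactor k i =
  ((+ l / (j ! ℕ.* l !)) {{j !* l !≢0}} ·ₚ ((Xₚ ^ₚ j) *ₚ (oneMinusXₚ ^ₚ (l ∸ 1))))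
  +ₚ ((ℚ.- ((+ j / (j ! ℕ.* l !)) {{j !* l !≢0}})) ·ₚ ((Xₚ ^ₚ (j ∸ 1)) *ₚ (oneMinusXₚ ^ₚ l)))
  where
    j = toℕ i
    l = k ∸ suc j

sumℚ : ∀ {n} → (Fin n → ℚ) → ℚ
sumℚ {zero}  f = 0ℚ
sumℚ {suc n} f = f Fin.zero ℚ.+ sumℚ (λ i → f (Fin.suc i))
  where import Data.Fin as Fin

-- Coefficient of α^a β^b in the gradient polynomial P_π:
--   P_π(α,β) = k! Σ_m F_m(α) F_{π(m)}(β)
gradCoeff : (k : ℕ) → Permutation′ k → ℕ → ℕ → ℚ
gradCoeff k π a b =
  (+ (k !) / 1) ℚ.* sumℚ (λ i → coeff (gradFactor k i) a ℚ.* coeff (gradFactor k (π ⟨$⟩ʳ i)) b)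

module _ {c ℓ : Level} (R : CommutativeRing c ℓ) where
  open CommutativeRing R

  sumR : ∀ {n} → (Fin n → Carrier) → Carrier
  sumR {zero}  f = 0#
  sumR {suc n} f = f Fin.zero + sumR (λ i → f (Fin.suc i))
    where import Data.Fin as Fin

  -- R is a ℚ-algebra via the ring homomorphism ι : ℚ → R
  IsℚEmbedding : (ℚ → Carrier) → Set ℓ
  IsℚEmbedding ι = IsRingHomomorphism +-*-rawRing rawRing ι

  permMatrix : ∀ {k} → Permutation′ k → Fin k → Fin k → Carrier
  permMatrix π r s with π ⟨$⟩ʳ r ≟ s
  ... | yes _ = 1#
  ... | no  _ = 0#

  coverMatrix : ∀ {k m} → (Fin m → Carrier) → (Fin m → Permutation′ k) →
                Fin k → Fin k → Carrier
  coverMatrix t π r s = sumR (λ i → t i * permMatrix (π i) r s)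

  combGradCoeff : ∀ {k m} → (ℚ → Carrier) → (Fin m → Carrier) →
                  (Fin m → Permutation′ k) → ℕ → ℕ → Carrier
  combGradCoeff {k} ι t π a b = sumR (λ i → t i * ι (gradCoeff k (π i) a b))

module Submission where

-- Write F_r (r < k) for the univariate factor of P_π, so that Σ_i t_i P_{π_i}(α, β) equals
-- k! Σ_{r,s} C_{rs} F_r(α) F_s(β) with C the cover matrix. Each F_r is a difference
-- E_r - E_{r-1} of consecutive Bernstein polynomials of degree k - 2 scaled by 1/(k-2)!,
-- with E_{-1} = E_{k-1} = 0. Summing by parts in both variables turns the vanishing form
-- into Σ_{p,q} D_{pq} E_p(α) E_q(β) = 0, where D is the mixed second difference of C.
-- The E_p are linearly independent (the lowest monomial of E_p is x^p), so D = 0, i.e.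
-- C_{rs} = a_r + b_s. Every row and every column of C sums to Σ_i t_i, and k is invertible
-- in the ℚ-algebra R, so a and b are constant.

open import Defs
open import Level using (Level; _⊔_)
open import Data.Nat using (ℕ; zero; suc; _∸_; _<_; z<s; s<s)
open import Data.Fin using (Fin; zero; suc; toℕ; inject₁; fromℕ; punchIn)
open import Data.Rational using (ℚ)
open import Algebra.Bundles using (CommutativeRing)
open import Data.Fin.Permutation using (Permutation′; _⟨$⟩ʳ_; _⟨$⟩ˡ_; inverseˡ; inverseʳ)

module Polynomials where
  open import Data.Nat as ℕ using (_!)
  open import Data.Nat.Properties as ℕ using (_!*_!≢0)
  import Data.Integer as ℤ
  import Data.Integer.Properties as ℤ
  open import Data.Fin.Properties using (toℕ-inject₁; toℕ-fromℕ)
  open import Data.List using ([]; _∷_)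
  open import Data.Rational as ℚ using (0ℚ; 1ℚ; _/_)
  import Data.Rational.Unnormalised as ℚᵘ
  import Data.Rational.Properties as ℚ
  open import Relation.Binary.PropositionalEquality
  import Algebra.Properties.CommutativeSemigroup as CommSemigroup

  coeff-+ₚ : ∀ p q n → coeff (p +ₚ q) n ≡ coeff p n ℚ.+ coeff q n
  coeff-+ₚ []      q       n       = sym (ℚ.+-identityˡ (coeff q n))
  coeff-+ₚ (a ∷ p) []      n       = sym (ℚ.+-identityʳ (coeff (a ∷ p) n))
  coeff-+ₚ (a ∷ p) (b ∷ q) zero    = refl
  coeff-+ₚ (a ∷ p) (b ∷ q) (suc n) = coeff-+ₚ p q n

  coeff-·ₚ : ∀ c p n → coeff (c ·ₚ p) n ≡ c ℚ.* coeff p n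
  coeff-·ₚ c []      n       = sym (ℚ.*-zeroʳ c)
  coeff-·ₚ c (a ∷ p) zero    = refl
  coeff-·ₚ c (a ∷ p) (suc n) = coeff-·ₚ c p n

  coeff-*ₚ-zero : ∀ p q → coeff (p *ₚ q) 0 ≡ coeff p 0 ℚ.* coeff q 0
  coeff-*ₚ-zero []      q = sym (ℚ.*-zeroˡ (coeff q 0))
  coeff-*ₚ-zero (a ∷ p) q =
    trans (coeff-+ₚ (a ·ₚ q) (0ℚ ∷ (p *ₚ q)) 0) (trans (ℚ.+-identityʳ _) (coeff-·ₚ a q 0))

  coeff-0∷-*ₚ : ∀ {a} p q n → a ≡ 0ℚ → coeff ((a ∷ p) *ₚ q) (suc n) ≡ coeff (p *ₚ q) n
  coeff-0∷-*ₚ p q n refl = begin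
    coeff ((0ℚ ·ₚ q) +ₚ (0ℚ ∷ (p *ₚ q))) (suc n)     ≡⟨ coeff-+ₚ (0ℚ ·ₚ q) _ (suc n) ⟩
    coeff (0ℚ ·ₚ q) (suc n) ℚ.+ coeff (p *ₚ q) n    ≡⟨ cong (ℚ._+ coeff (p *ₚ q) n) (coeff-·ₚ 0ℚ q (suc n)) ⟩
    0ℚ ℚ.* coeff q (suc n) ℚ.+ coeff (p *ₚ q) n     ≡⟨ cong (ℚ._+ coeff (p *ₚ q) n) (ℚ.*-zeroˡ (coeff q (suc n))) ⟩
    0ℚ ℚ.+ coeff (p *ₚ q) n                         ≡⟨ ℚ.+-identityˡ _ ⟩
    coeff (p *ₚ q) n                                ∎
    where open ≡-Reasoning

  coeff-1ₚ-*ₚ : ∀ q n → coeff ((1ℚ ∷ []) *ₚ q) n ≡ coeff q n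
  coeff-1ₚ-*ₚ q n = begin
    coeff ((1ℚ ·ₚ q) +ₚ (0ℚ ∷ [])) n        ≡⟨ coeff-+ₚ (1ℚ ·ₚ q) (0ℚ ∷ []) n ⟩
    coeff (1ℚ ·ₚ q) n ℚ.+ coeff (0ℚ ∷ []) n ≡⟨ cong₂ ℚ._+_ (coeff-·ₚ 1ℚ q n) (coeff-0ₚ n) ⟩
    1ℚ ℚ.* coeff q n ℚ.+ 0ℚ                 ≡⟨ ℚ.+-identityʳ _ ⟩
    1ℚ ℚ.* coeff q n                        ≡⟨ ℚ.*-identityˡ _ ⟩
    coeff q n                               ∎
    where
    open ≡-Reasoning
    coeff-0ₚ : ∀ n → coeff (0ℚ ∷ []) n ≡ 0ℚ
    coeff-0ₚ zero    = refl
    coeff-0ₚ (suc n) = refl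

  VanishesBelow : ℕ → Poly → Set
  VanishesBelow j p = ∀ n → n < j → coeff p n ≡ 0ℚ

  *ₚ-vanishesBelow : ∀ j p q → VanishesBelow j p → VanishesBelow j (p *ₚ q)
  *ₚ-vanishesBelow (suc j) []      q p₀ n       _         = refl
  *ₚ-vanishesBelow (suc j) (a ∷ p) q p₀ zero    _         =
    trans (coeff-*ₚ-zero (a ∷ p) q) (trans (cong (ℚ._* coeff q 0) (p₀ 0 z<s)) (ℚ.*-zeroˡ (coeff q 0)))
  *ₚ-vanishesBelow (suc j) (a ∷ p) q p₀ (suc n) (s<s n<j) =
    trans (coeff-0∷-*ₚ p q n (p₀ 0 z<s)) (*ₚ-vanishesBelow j p q (λ n n<j → p₀ (suc n) (s<s n<j)) n n<j)

  coeff-*ₚ-lowest : ∀ j p q → VanishesBelow j p → coeff (p *ₚ q) j ≡ coeff p j ℚ.* coeff q 0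
  coeff-*ₚ-lowest zero    p       q _  = coeff-*ₚ-zero p q
  coeff-*ₚ-lowest (suc j) []      q _  = sym (ℚ.*-zeroˡ (coeff q 0))
  coeff-*ₚ-lowest (suc j) (a ∷ p) q p₀ =
    trans (coeff-0∷-*ₚ p q j (p₀ 0 z<s)) (coeff-*ₚ-lowest j p q (λ n n<j → p₀ (suc n) (s<s n<j)))

  Xₚ^ₚ-vanishesBelow : ∀ j → VanishesBelow j (Xₚ ^ₚ j)
  Xₚ^ₚ-vanishesBelow (suc j) zero    _         = trans (coeff-*ₚ-zero Xₚ (Xₚ ^ₚ j)) (ℚ.*-zeroˡ (coeff (Xₚ ^ₚ j) 0))
  Xₚ^ₚ-vanishesBelow (suc j) (suc n) (s<s n<j) =
    trans (coeff-0∷-*ₚ (1ℚ ∷ []) (Xₚ ^ₚ j) n refl) (trans (coeff-1ₚ-*ₚ (Xₚ ^ₚ j) n) (Xₚ^ₚ-vanishesBelow j n n<j))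

  coeff-Xₚ^ₚ-diag : ∀ j → coeff (Xₚ ^ₚ j) j ≡ 1ℚ
  coeff-Xₚ^ₚ-diag zero    = refl
  coeff-Xₚ^ₚ-diag (suc j) =
    trans (coeff-0∷-*ₚ (1ℚ ∷ []) (Xₚ ^ₚ j) j refl) (trans (coeff-1ₚ-*ₚ (Xₚ ^ₚ j) j) (coeff-Xₚ^ₚ-diag j))

  coeff-oneMinusXₚ^ₚ-zero : ∀ l → coeff (oneMinusXₚ ^ₚ l) 0 ≡ 1ℚ
  coeff-oneMinusXₚ^ₚ-zero zero    = refl
  coeff-oneMinusXₚ^ₚ-zero (suc l) =
    trans (coeff-*ₚ-zero oneMinusXₚ (oneMinusXₚ ^ₚ l))
          (trans (cong (1ℚ ℚ.*_) (coeff-oneMinusXₚ^ₚ-zero l)) (ℚ.*-identityˡ 1ℚ))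

  1/[j!*l!] : ℕ → ℕ → ℚ
  1/[j!*l!] j l = (ℤ.+ 1 / (j ! ℕ.* l !)) {{j !* l !≢0}}

  -- x^j (1 - x)^l / (j! l!) is the Bernstein polynomial b_{j,j+l} divided by (j + l)!.
  bernstein : ℕ → ℕ → ℕ → ℚ
  bernstein j l a = 1/[j!*l!] j l ℚ.* coeff ((Xₚ ^ₚ j) *ₚ (oneMinusXₚ ^ₚ l)) a

  bernstein-vanishesBelow : ∀ j l a → a < j → bernstein j l a ≡ 0ℚ
  bernstein-vanishesBelow j l a a<j =
    trans (cong (1/[j!*l!] j l ℚ.*_) (*ₚ-vanishesBelow j (Xₚ ^ₚ j) (oneMinusXₚ ^ₚ l) (Xₚ^ₚ-vanishesBelow j) a a<j))
          (ℚ.*-zeroʳ (1/[j!*l!] j l))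

  bernstein-diag : ∀ j l → bernstein j l j ≡ 1/[j!*l!] j l
  bernstein-diag j l = begin
    c ℚ.* coeff ((Xₚ ^ₚ j) *ₚ (oneMinusXₚ ^ₚ l)) j
      ≡⟨ cong (c ℚ.*_) (coeff-*ₚ-lowest j (Xₚ ^ₚ j) (oneMinusXₚ ^ₚ l) (Xₚ^ₚ-vanishesBelow j)) ⟩
    c ℚ.* (coeff (Xₚ ^ₚ j) j ℚ.* coeff (oneMinusXₚ ^ₚ l) 0)
      ≡⟨ cong (c ℚ.*_) (cong₂ ℚ._*_ (coeff-Xₚ^ₚ-diag j) (coeff-oneMinusXₚ^ₚ-zero l)) ⟩
    c ℚ.* (1ℚ ℚ.* 1ℚ)
      ≡⟨ ℚ.*-identityʳ c ⟩
    c ∎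
    where
    open ≡-Reasoning
    c = 1/[j!*l!] j l

  bernstein-diag-positive : ∀ j l → ℚ.Positive (bernstein j l j)
  bernstein-diag-positive j l =
    subst ℚ.Positive (sym (bernstein-diag j l)) (ℚ.normalize-pos 1 (j ! ℕ.* l !) {{j !* l !≢0}})

  /-cross : ∀ a b c d .{{_ : ℕ.NonZero b}} .{{_ : ℕ.NonZero d}} →
            a ℕ.* d ≡ c ℕ.* b → ℤ.+ a / b ≡ ℤ.+ c / d
  /-cross a (suc b) c (suc d) ad≡cb = ℚ.fromℚᵘ-cong {ℚᵘ.mkℚᵘ (ℤ.+ a) b} {ℚᵘ.mkℚᵘ (ℤ.+ c) d} (ℚᵘ.*≡*
    (trans (sym (ℤ.pos-* a (suc d))) (trans (cong ℤ.+_ ad≡cb) (ℤ.pos-* c (suc b)))))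

  gradFactor⁺ gradFactor⁻ : ℕ → ℕ → ℕ → ℚ
  gradFactor⁺ j l a =
    (ℤ.+ l / (j ! ℕ.* l !)) {{j !* l !≢0}} ℚ.* coeff ((Xₚ ^ₚ j) *ₚ (oneMinusXₚ ^ₚ (l ∸ 1))) a
  gradFactor⁻ j l a =
    (ℤ.+ j / (j ! ℕ.* l !)) {{j !* l !≢0}} ℚ.* coeff ((Xₚ ^ₚ (j ∸ 1)) *ₚ (oneMinusXₚ ^ₚ l)) a

  coeff-gradFactor : ∀ k i a → let j = toℕ i; l = k ∸ suc j in
                     coeff (gradFactor k i) a ≡ gradFactor⁺ j l a ℚ.- gradFactor⁻ j l a
  coeff-gradFactor k i a =
    trans (coeff-+ₚ (c⁺ ·ₚ P⁺) (ℚ.- c⁻ ·ₚ P⁻) a)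
          (cong₂ ℚ._+_ (coeff-·ₚ c⁺ P⁺ a)
                       (trans (coeff-·ₚ (ℚ.- c⁻) P⁻ a) (sym (ℚ.neg-distribˡ-* c⁻ (coeff P⁻ a)))))
    where
    j = toℕ i
    l = k ∸ suc j
    c⁺ = (ℤ.+ l / (j ! ℕ.* l !)) {{j !* l !≢0}}
    c⁻ = (ℤ.+ j / (j ! ℕ.* l !)) {{j !* l !≢0}}
    P⁺ = (Xₚ ^ₚ j) *ₚ (oneMinusXₚ ^ₚ (l ∸ 1))
    P⁻ = (Xₚ ^ₚ (j ∸ 1)) *ₚ (oneMinusXₚ ^ₚ l)

  gradFactor⁺-zero : ∀ j a → gradFactor⁺ j 0 a ≡ 0ℚ
  gradFactor⁺-zero j a =
    trans (cong (ℚ._* coeff ((Xₚ ^ₚ j) *ₚ (oneMinusXₚ ^ₚ 0)) a) (ℚ.0/n≡0 (j ! ℕ.* 1) {{j !* 0 !≢0}}))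
          (ℚ.*-zeroˡ (coeff ((Xₚ ^ₚ j) *ₚ (oneMinusXₚ ^ₚ 0)) a))

  gradFactor⁻-zero : ∀ l a → gradFactor⁻ 0 l a ≡ 0ℚ
  gradFactor⁻-zero l a =
    trans (cong (ℚ._* coeff ((Xₚ ^ₚ 0) *ₚ (oneMinusXₚ ^ₚ l)) a) (ℚ.0/n≡0 (1 ℕ.* l !) {{0 !* l !≢0}}))
          (ℚ.*-zeroˡ (coeff ((Xₚ ^ₚ 0) *ₚ (oneMinusXₚ ^ₚ l)) a))

  gradFactor⁺-suc : ∀ j l a → gradFactor⁺ j (suc l) a ≡ bernstein j l a
  gradFactor⁺-suc j l a = cong (ℚ._* coeff ((Xₚ ^ₚ j) *ₚ (oneMinusXₚ ^ₚ l)) a)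
    (/-cross (suc l) (j ! ℕ.* suc l !) 1 (j ! ℕ.* l !) {{j !* suc l !≢0}} {{j !* l !≢0}} (begin
      suc l ℕ.* (j ! ℕ.* l !)  ≡⟨ CommSemigroup.x∙yz≈y∙xz ℕ.*-commutativeSemigroup (suc l) (j !) (l !) ⟩
      j ! ℕ.* suc l !          ≡⟨ ℕ.*-identityˡ _ ⟨
      1 ℕ.* (j ! ℕ.* suc l !)  ∎))
    where open ≡-Reasoning

  gradFactor⁻-suc : ∀ j l a → gradFactor⁻ (suc j) l a ≡ bernstein j l a
  gradFactor⁻-suc j l a = cong (ℚ._* coeff ((Xₚ ^ₚ j) *ₚ (oneMinusXₚ ^ₚ l)) a)
    (/-cross (suc j) (suc j ! ℕ.* l !) 1 (j ! ℕ.* l !) {{suc j !* l !≢0}} {{j !* l !≢0}}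
      (trans (sym (ℕ.*-assoc (suc j) (j !) (l !))) (sym (ℕ.*-identityˡ _))))

  gradFactor⁺-inject₁ : ∀ K (p : Fin K) a → let j = toℕ (inject₁ p) in
                        gradFactor⁺ j (K ∸ j) a ≡ bernstein (toℕ p) (K ∸ suc (toℕ p)) a
  gradFactor⁺-inject₁ K p a rewrite toℕ-inject₁ p =
    trans (cong (λ l → gradFactor⁺ (toℕ p) l a) (∸-toℕ p)) (gradFactor⁺-suc (toℕ p) _ a)
    where
    ∸-toℕ : ∀ {K} (p : Fin K) → K ∸ toℕ p ≡ suc (K ∸ suc (toℕ p))
    ∸-toℕ {suc K} zero    = refl
    ∸-toℕ {suc K} (suc p) = ∸-toℕ p

  gradFactor⁺-last : ∀ K a → let j = toℕ (fromℕ K) in gradFactor⁺ j (K ∸ j) a ≡ 0ℚ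
  gradFactor⁺-last K a rewrite toℕ-fromℕ K | ℕ.n∸n≡0 K = gradFactor⁺-zero K a

open Polynomials

module _ {c ℓ : Level} (R : CommutativeRing c ℓ) where
  open CommutativeRing R hiding (zero)
  open import Relation.Binary.PropositionalEquality as ≡ using (_≡_; _≢_)
  open import Data.Fin.Properties using (punchInᵢ≢i)
  open import Data.Vec.Functional using (removeAt)
  import Data.Fin as Fin
  open import Function using (_∘_)
  open import Relation.Nullary using (yes; no; contradiction)
  open import Algebra.Properties.Ring ring
    using ( -1*x≈-x; x[y-z]≈xy-xz; [y-z]x≈yx-zx; +-identityˡ-unique; -‿+-comm
          ; x∙y⁻¹≈ε⇒x≈y; x≈y⇒x∙y⁻¹≈ε; //-rightDividesˡ)
  open import Algebra.Properties.Semiring.Sum semiring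
  open import Algebra.Properties.Semiring.Mult semiring using (_×_; ×-congʳ; ×-assoc-*)
  open import Algebra.Properties.CommutativeSemigroup +-commutativeSemigroup using (interchange)
  open import Algebra.Properties.CommutativeSemigroup *-commutativeSemigroup using (x∙yz≈y∙xz)
  open import Relation.Binary.Reasoning.Setoid setoid

  sumR≡sum : ∀ {n} (f : Fin n → Carrier) → sumR R f ≡ sum f
  sumR≡sum {zero}  f = ≡.refl
  sumR≡sum {suc n} f = ≡.cong (f zero +_) (sumR≡sum (λ i → f (suc i)))

  sub-interchange : ∀ a b c d → (a - b) - (c - d) ≈ (a - c) - (b - d)
  sub-interchange a b c d = begin
    (a - b) - (c - d)          ≈⟨ +-congˡ (-‿+-comm c (- d)) ⟨
    (a - b) + (- c + - (- d))  ≈⟨ interchange a (- b) (- c) (- (- d)) ⟩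
    (a - c) + (- b + - (- d))  ≈⟨ +-congˡ (-‿+-comm b (- d)) ⟩
    (a - c) - (b - d)          ∎

  ∑[f-g]≈∑f-∑g : ∀ {n} (f g : Fin n → Carrier) → ∑[ i < n ] (f i - g i) ≈ ∑[ i < n ] f i - ∑[ i < n ] g i
  ∑[f-g]≈∑f-∑g {n} f g = begin
    ∑[ i < n ] (f i - g i)              ≈⟨ ∑-distrib-+ f (λ i → - g i) ⟩
    sum f + ∑[ i < n ] (- g i)          ≈⟨ +-congˡ (sum-cong-≋ (λ i → -1*x≈-x (g i))) ⟨
    sum f + ∑[ i < n ] (- 1# * g i)     ≈⟨ +-congˡ (*-distribˡ-sum (- 1#) g) ⟨
    sum f + - 1# * sum g                ≈⟨ +-congˡ (-1*x≈-x (sum g)) ⟩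
    sum f - sum g                       ∎

  *-distribˡ-∑-* : ∀ {n} x (t y : Fin n → Carrier) →
                   x * ∑[ i < n ] (t i * y i) ≈ ∑[ i < n ] (t i * (x * y i))
  *-distribˡ-∑-* x t y =
    trans (*-distribˡ-sum x (λ i → t i * y i)) (sum-cong-≋ (λ i → x∙yz≈y∙xz x (t i) (y i)))

  ∑-≈0 : ∀ {n} (f : Fin n → Carrier) → (∀ i → f i ≈ 0#) → sum f ≈ 0#
  ∑-≈0 {n} f f≈0 = trans (sum-cong-≋ f≈0) (sum-replicate-zero n)

  ∑-delta : ∀ {n} (f : Fin n → Carrier) i → (∀ j → j ≢ i → f j ≈ 0#) → sum f ≈ f i
  ∑-delta {suc n} f i f≈0 = begin
    sum f                        ≈⟨ sum-remove f ⟩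
    f i + sum (removeAt f i)     ≈⟨ +-congˡ (∑-≈0 (removeAt f i) (λ j → f≈0 (punchIn i j) (punchInᵢ≢i i j))) ⟩
    f i + 0#                     ≈⟨ +-identityʳ (f i) ⟩
    f i                          ∎

  Δ : ∀ {n} → (Fin (suc n) → Carrier) → Fin n → Carrier
  Δ x p = x (inject₁ p) - x (suc p)

  ∑-by-parts : ∀ {n} (u v x : Fin (suc n) → Carrier) (e : Fin n → Carrier) →
               (∀ p → u (inject₁ p) ≈ e p) → u (fromℕ n) ≈ 0# →
               v zero ≈ 0# → (∀ p → v (suc p) ≈ e p) →
               ∑[ r < suc n ] ((u r - v r) * x r) ≈ ∑[ p < n ] (e p * Δ x p)
  ∑-by-parts {n} u v x e u≈e uₙ≈0 v₀≈0 v≈e = begin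
    ∑[ r < suc n ] ((u r - v r) * x r)
      ≈⟨ sum-cong-≋ (λ r → [y-z]x≈yx-zx (x r) (u r) (v r)) ⟩
    ∑[ r < suc n ] (u r * x r - v r * x r)
      ≈⟨ ∑[f-g]≈∑f-∑g (λ r → u r * x r) (λ r → v r * x r) ⟩
    ∑[ r < suc n ] (u r * x r) - ∑[ r < suc n ] (v r * x r)
      ≈⟨ +-cong ∑ux (-‿cong ∑vx) ⟩
    ∑[ p < n ] (e p * x (inject₁ p)) - ∑[ p < n ] (e p * x (suc p))
      ≈⟨ ∑[f-g]≈∑f-∑g (λ p → e p * x (inject₁ p)) (λ p → e p * x (suc p)) ⟨
    ∑[ p < n ] (e p * x (inject₁ p) - e p * x (suc p))
      ≈⟨ sum-cong-≋ (λ p → x[y-z]≈xy-xz (e p) (x (inject₁ p)) (x (suc p))) ⟨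
    ∑[ p < n ] (e p * Δ x p) ∎
    where
    ∑ux : ∑[ r < suc n ] (u r * x r) ≈ ∑[ p < n ] (e p * x (inject₁ p))
    ∑ux = begin
      ∑[ r < suc n ] (u r * x r)                                     ≈⟨ sum-init-last (λ r → u r * x r) ⟩
      ∑[ p < n ] (u (inject₁ p) * x (inject₁ p)) + u (fromℕ n) * x (fromℕ n)
        ≈⟨ +-cong (sum-cong-≋ (λ p → *-congʳ (u≈e p))) (trans (*-congʳ uₙ≈0) (zeroˡ _)) ⟩
      ∑[ p < n ] (e p * x (inject₁ p)) + 0#                          ≈⟨ +-identityʳ _ ⟩
      ∑[ p < n ] (e p * x (inject₁ p))                               ∎
    ∑vx : ∑[ r < suc n ] (v r * x r) ≈ ∑[ p < n ] (e p * x (suc p))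
    ∑vx = begin
      v zero * x zero + ∑[ p < n ] (v (suc p) * x (suc p))
        ≈⟨ +-cong (trans (*-congʳ v₀≈0) (zeroˡ _)) (sum-cong-≋ (λ p → *-congʳ (v≈e p))) ⟩
      0# + ∑[ p < n ] (e p * x (suc p))                               ≈⟨ +-identityˡ _ ⟩
      ∑[ p < n ] (e p * x (suc p))                                    ∎

  Δ≈0⇒constant : ∀ {n} (x : Fin (suc n) → Carrier) → (∀ p → Δ x p ≈ 0#) → ∀ r → x r ≈ x zero
  Δ≈0⇒constant         x Δx≈0 zero    = refl
  Δ≈0⇒constant {suc n} x Δx≈0 (suc r) =
    trans (sym (x∙y⁻¹≈ε⇒x≈y _ _ (Δx≈0 r))) (Δ≈0⇒constant (λ r → x (inject₁ r)) (λ p → Δx≈0 (inject₁ p)) r)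

  Δ[x-y]≈Δx-Δy : ∀ {n} (x y : Fin (suc n) → Carrier) p → Δ (λ r → x r - y r) p ≈ Δ x p - Δ y p
  Δ[x-y]≈Δx-Δy x y p = sub-interchange (x (inject₁ p)) (y (inject₁ p)) (x (suc p)) (y (suc p))

  Δ²≈0⇒separable : ∀ {n} (M : Fin (suc n) → Fin (suc n) → Carrier) →
                   (∀ p q → Δ (λ s → Δ (λ r → M r s) p) q ≈ 0#) →
                   ∀ r s → M r s - M r zero ≈ M zero s - M zero zero
  Δ²≈0⇒separable M Δ²M≈0 r s = Δ≈0⇒constant (λ r → M r s - M r zero) Δ≈0 r
    where
    Δ≈0 : ∀ p → Δ (λ r → M r s - M r zero) p ≈ 0#
    Δ≈0 p = trans (Δ[x-y]≈Δx-Δy (λ r → M r s) (λ r → M r zero) p)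
                  (x≈y⇒x∙y⁻¹≈ε (Δ≈0⇒constant (λ s → Δ (λ r → M r s) p) (Δ²M≈0 p) s))

  NoTorsion : ℕ → Set (c ⊔ ℓ)
  NoTorsion n = ∀ x → n × x ≈ 0# → x ≈ 0#

  ∑-translate≈∑⇒≈0 : ∀ {n} → NoTorsion n → ∀ a (f : Fin n → Carrier) →
                     ∑[ i < n ] (a + f i) ≈ sum f → a ≈ 0#
  ∑-translate≈∑⇒≈0 {n} noTorsion a f eq = noTorsion a (+-identityˡ-unique (n × a) (sum f) (begin
    n × a + sum f                  ≈⟨ +-congʳ (sum-replicate n) ⟨
    sum {n} (λ _ → a) + sum f      ≈⟨ ∑-distrib-+ (λ _ → a) f ⟨
    ∑[ i < n ] (a + f i)           ≈⟨ eq ⟩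
    sum f                          ∎))

  separable⇒constant : ∀ {n} (M : Fin (suc n) → Fin (suc n) → Carrier) → NoTorsion (suc n) →
                       (∀ r s → M r s - M r zero ≈ M zero s - M zero zero) →
                       (∀ r → ∑[ s < suc n ] M r s ≈ ∑[ s < suc n ] M zero s) →
                       (∀ s → ∑[ r < suc n ] M r s ≈ ∑[ r < suc n ] M r zero) →
                       ∀ r s → M r s ≈ M zero zero
  separable⇒constant {n} M noTorsion separable rows cols r s = begin
    M r s                                   ≈⟨ //-rightDividesˡ (M r zero) (M r s) ⟨
    (M r s - M r zero) + M r zero
      ≈⟨ +-cong (trans (separable r s) (x≈y⇒x∙y⁻¹≈ε (firstRow s))) (firstColumn r) ⟩
    0# + M zero zero                        ≈⟨ +-identityˡ (M zero zero) ⟩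
    M zero zero                             ∎
    where
    firstColumn : ∀ r → M r zero ≈ M zero zero
    firstColumn r = x∙y⁻¹≈ε⇒x≈y _ _ (∑-translate≈∑⇒≈0 noTorsion _ (M zero) (begin
      ∑[ s < suc n ] ((M r zero - M zero zero) + M zero s)   ≈⟨ sum-cong-≋ rowForm ⟨
      ∑[ s < suc n ] M r s                                   ≈⟨ rows r ⟩
      ∑[ s < suc n ] M zero s                                ∎))
      where
      rowForm : ∀ s → M r s ≈ (M r zero - M zero zero) + M zero s
      rowForm s = begin
        M r s                                   ≈⟨ //-rightDividesˡ (M zero s) (M r s) ⟨
        (M r s - M zero s) + M zero s
          ≈⟨ +-congʳ (x∙y⁻¹≈ε⇒x≈y _ _ (trans (sub-interchange _ _ _ _) (x≈y⇒x∙y⁻¹≈ε (separable r s)))) ⟩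
        (M r zero - M zero zero) + M zero s     ∎
    firstRow : ∀ s → M zero s ≈ M zero zero
    firstRow s = x∙y⁻¹≈ε⇒x≈y _ _ (∑-translate≈∑⇒≈0 noTorsion _ (λ r → M r zero) (begin
      ∑[ r < suc n ] ((M zero s - M zero zero) + M r zero)   ≈⟨ sum-cong-≋ columnForm ⟨
      ∑[ r < suc n ] M r s                                   ≈⟨ cols s ⟩
      ∑[ r < suc n ] M r zero                                ∎))
      where
      columnForm : ∀ r → M r s ≈ (M zero s - M zero zero) + M r zero
      columnForm r = trans (sym (//-rightDividesˡ (M r zero) (M r s))) (+-congʳ (separable r s))

  triangular⇒trivial : ∀ {n} (e : Fin n → ℕ → Carrier) (z : Fin n → Carrier) →
                       (∀ p a → a < toℕ p → e p a ≈ 0#) →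
                       (∀ p y → e p (toℕ p) * y ≈ 0# → y ≈ 0#) →
                       (∀ a → ∑[ p < n ] (e p a * z p) ≈ 0#) →
                       ∀ p → z p ≈ 0#
  triangular⇒trivial {suc n} e z below diag eqs = λ where
      zero    → z₀≈0
      (suc p) → triangular⇒trivial (λ p a → e (suc p) (suc a)) (λ p → z (suc p))
                  (λ p a a<p → below (suc p) (suc a) (s<s a<p)) (λ p → diag (suc p)) eqs′ p
    where
    z₀≈0 : z zero ≈ 0#
    z₀≈0 = diag zero (z zero) (begin
      e zero 0 * z zero                                         ≈⟨ +-identityʳ _ ⟨
      e zero 0 * z zero + 0#
        ≈⟨ +-congˡ (∑-≈0 _ (λ p → trans (*-congʳ (below (suc p) 0 z<s)) (zeroˡ (z (suc p))))) ⟨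
      e zero 0 * z zero + ∑[ p < n ] (e (suc p) 0 * z (suc p))  ≈⟨ eqs 0 ⟩
      0#                                                        ∎)
    eqs′ : ∀ a → ∑[ p < n ] (e (suc p) (suc a) * z (suc p)) ≈ 0#
    eqs′ a = begin
      ∑[ p < n ] (e (suc p) (suc a) * z (suc p))                            ≈⟨ +-identityˡ _ ⟨
      0# + ∑[ p < n ] (e (suc p) (suc a) * z (suc p))
        ≈⟨ +-congʳ (trans (*-congˡ z₀≈0) (zeroʳ (e zero (suc a)))) ⟨
      e zero (suc a) * z zero + ∑[ p < n ] (e (suc p) (suc a) * z (suc p))  ≈⟨ eqs (suc a) ⟩
      0#                                                                    ∎

  permMatrix-≡ : ∀ {k} (π : Permutation′ k) r s → π ⟨$⟩ʳ r ≡ s → permMatrix R π r s ≈ 1#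
  permMatrix-≡ π r s πr≡s with π ⟨$⟩ʳ r Fin.≟ s
  ... | yes _    = refl
  ... | no πr≢s = contradiction πr≡s πr≢s

  permMatrix-≢ : ∀ {k} (π : Permutation′ k) r s → π ⟨$⟩ʳ r ≢ s → permMatrix R π r s ≈ 0#
  permMatrix-≢ π r s πr≢s with π ⟨$⟩ʳ r Fin.≟ s
  ... | yes πr≡s = contradiction πr≡s πr≢s
  ... | no _     = refl

  ∑-*-permMatrix : ∀ {k} (π : Permutation′ k) (g : Fin k → Carrier) r →
                   ∑[ s < k ] (g s * permMatrix R π r s) ≈ g (π ⟨$⟩ʳ r)
  ∑-*-permMatrix π g r = begin
    ∑[ s < _ ] (g s * permMatrix R π r s)
      ≈⟨ ∑-delta _ (π ⟨$⟩ʳ r) (λ s s≢πr →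
           trans (*-congˡ (permMatrix-≢ π r s (s≢πr ∘ ≡.sym))) (zeroʳ (g s))) ⟩
    g (π ⟨$⟩ʳ r) * permMatrix R π r (π ⟨$⟩ʳ r)  ≈⟨ *-congˡ (permMatrix-≡ π r _ ≡.refl) ⟩
    g (π ⟨$⟩ʳ r) * 1#                           ≈⟨ *-identityʳ _ ⟩
    g (π ⟨$⟩ʳ r)                                ∎

  ∑-permMatrix-row : ∀ {k} (π : Permutation′ k) r → ∑[ s < k ] permMatrix R π r s ≈ 1#
  ∑-permMatrix-row {k} π r =
    trans (sum-cong-≋ {k} (λ s → sym (*-identityˡ (permMatrix R π r s)))) (∑-*-permMatrix π (λ _ → 1#) r)

  ∑-permMatrix-column : ∀ {k} (π : Permutation′ k) s → ∑[ r < k ] permMatrix R π r s ≈ 1#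
  ∑-permMatrix-column π s = trans
    (∑-delta _ (π ⟨$⟩ˡ s) (λ r r≢π⁻¹s → permMatrix-≢ π r s (λ πr≡s →
      r≢π⁻¹s (≡.trans (≡.sym (inverseˡ π)) (≡.cong (π ⟨$⟩ˡ_) πr≡s)))))
    (permMatrix-≡ π _ s (inverseʳ π))

  ∑-∑-*-normalised : ∀ {m n} (t : Fin m → Carrier) (A : Fin m → Fin n → Carrier) →
                     (∀ i → ∑[ j < n ] A i j ≈ 1#) →
                     ∑[ j < n ] ∑[ i < m ] (t i * A i j) ≈ sum t
  ∑-∑-*-normalised {m} {n} t A ∑A≈1 = begin
    ∑[ j < n ] ∑[ i < m ] (t i * A i j)  ≈⟨ ∑-comm (λ i j → t i * A i j) ⟨
    ∑[ i < m ] ∑[ j < n ] (t i * A i j)  ≈⟨ sum-cong-≋ (λ i → *-distribˡ-sum (t i) (A i)) ⟨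
    ∑[ i < m ] (t i * ∑[ j < n ] A i j)  ≈⟨ sum-cong-≋ (λ i → trans (*-congˡ (∑A≈1 i)) (*-identityʳ (t i))) ⟩
    ∑[ i < m ] t i                       ∎

  bilinearForm : ∀ {n} → (Fin n → Fin n → Carrier) → (Fin n → Carrier) → (Fin n → Carrier) → Carrier
  bilinearForm {n} M f g = ∑[ r < n ] (f r * ∑[ s < n ] (g s * M r s))

  bilinearForm-cong : ∀ {n} {M N : Fin n → Fin n → Carrier} → (∀ r s → M r s ≈ N r s) →
                      ∀ f g → bilinearForm M f g ≈ bilinearForm N f g
  bilinearForm-cong M≈N f g = sum-cong-≋ (λ r → *-congˡ (sum-cong-≋ (λ s → *-congˡ (M≈N r s))))

  bilinearForm-∑ : ∀ {m n} (t : Fin m → Carrier) (N : Fin m → Fin n → Fin n → Carrier) f g →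
                   bilinearForm (λ r s → ∑[ i < m ] (t i * N i r s)) f g ≈
                   ∑[ i < m ] (t i * bilinearForm (N i) f g)
  bilinearForm-∑ {m} {n} t N f g = begin
    ∑[ r < n ] (f r * ∑[ s < n ] (g s * ∑[ i < m ] (t i * N i r s)))
      ≈⟨ sum-cong-≋ (λ r → *-congˡ (sum-cong-≋ (λ s → *-distribˡ-∑-* (g s) t (λ i → N i r s)))) ⟩
    ∑[ r < n ] (f r * ∑[ s < n ] ∑[ i < m ] (t i * (g s * N i r s)))
      ≈⟨ sum-cong-≋ (λ r → *-congˡ (∑-comm (λ s i → t i * (g s * N i r s)))) ⟩
    ∑[ r < n ] (f r * ∑[ i < m ] ∑[ s < n ] (t i * (g s * N i r s)))
      ≈⟨ sum-cong-≋ (λ r → *-congˡ (sum-cong-≋ (λ i → *-distribˡ-sum (t i) (λ s → g s * N i r s)))) ⟨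
    ∑[ r < n ] (f r * ∑[ i < m ] (t i * ∑[ s < n ] (g s * N i r s)))
      ≈⟨ sum-cong-≋ (λ r → *-distribˡ-∑-* (f r) t (λ i → ∑[ s < n ] (g s * N i r s))) ⟩
    ∑[ r < n ] ∑[ i < m ] (t i * (f r * ∑[ s < n ] (g s * N i r s)))
      ≈⟨ ∑-comm (λ r i → t i * (f r * ∑[ s < n ] (g s * N i r s))) ⟩
    ∑[ i < m ] ∑[ r < n ] (t i * (f r * ∑[ s < n ] (g s * N i r s)))
      ≈⟨ sum-cong-≋ (λ i → *-distribˡ-sum (t i) (λ r → f r * ∑[ s < n ] (g s * N i r s))) ⟨
    ∑[ i < m ] (t i * bilinearForm (N i) f g)
      ∎

  bilinearForm-permMatrix : ∀ {k} (π : Permutation′ k) f g →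
                            bilinearForm (permMatrix R π) f g ≈ ∑[ r < k ] (f r * g (π ⟨$⟩ʳ r))
  bilinearForm-permMatrix π f g = sum-cong-≋ (λ r → *-congˡ (∑-*-permMatrix π g r))

  module _ {k m : ℕ} (t : Fin m → Carrier) (π : Fin m → Permutation′ k) where

    coverMatrix≈∑ : ∀ r s → coverMatrix R t π r s ≈ ∑[ i < m ] (t i * permMatrix R (π i) r s)
    coverMatrix≈∑ r s = reflexive (sumR≡sum (λ i → t i * permMatrix R (π i) r s))

    ∑-coverMatrix-row : ∀ r → ∑[ s < k ] coverMatrix R t π r s ≈ sum t
    ∑-coverMatrix-row r = trans (sum-cong-≋ (coverMatrix≈∑ r))
      (∑-∑-*-normalised t (λ i s → permMatrix R (π i) r s) (λ i → ∑-permMatrix-row (π i) r))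

    ∑-coverMatrix-column : ∀ s → ∑[ r < k ] coverMatrix R t π r s ≈ sum t
    ∑-coverMatrix-column s = trans (sum-cong-≋ (λ r → coverMatrix≈∑ r s))
      (∑-∑-*-normalised t (λ i r → permMatrix R (π i) r s) (λ i → ∑-permMatrix-column (π i) s))

  module _ (ι : ℚ → Carrier) (ι-hom : IsℚEmbedding R ι) where
    open import Algebra.Morphism.Structures using (IsRingHomomorphism)
    open IsRingHomomorphism ι-hom using (+-homo; *-homo; 0#-homo; 1#-homo; -‿homo)
    open import Data.Nat using (_!)
    open import Data.Nat.Properties using (_!≢0)
    import Data.Integer as ℤ
    open import Data.Rational as ℚ using (1ℚ; _/_)
    import Data.Rational.Properties as ℚ
    open import Algebra.Definitions.RawMonoid ℚ.+-0-rawMonoid using () renaming (_×_ to _×ℚ_)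

    ×1ℚ-positive : ∀ n → ℚ.Positive (suc n ×ℚ 1ℚ)
    ×1ℚ-positive n = ℚ.pos+nonNeg⇒pos 1ℚ (n ×ℚ 1ℚ) {{×1ℚ-nonNegative n}}
      where
      ×1ℚ-nonNegative : ∀ n → ℚ.NonNegative (n ×ℚ 1ℚ)
      ×1ℚ-nonNegative zero    = _
      ×1ℚ-nonNegative (suc n) = ℚ.nonNeg+nonNeg⇒nonNeg 1ℚ (n ×ℚ 1ℚ) {{×1ℚ-nonNegative n}}

    ι-≡ : ∀ {x y} → x ≡ y → ι x ≈ ι y
    ι-≡ x≡y = reflexive (≡.cong ι x≡y)

    ι[x-y]≈ιx-ιy : ∀ x y → ι (x ℚ.- y) ≈ ι x - ι y
    ι[x-y]≈ιx-ιy x y = trans (+-homo x (ℚ.- y)) (+-congˡ (-‿homo y))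

    ι-∑ : ∀ {n} (g : Fin n → ℚ) → ι (sumℚ g) ≈ ∑[ i < n ] ι (g i)
    ι-∑ {zero}  g = 0#-homo
    ι-∑ {suc n} g = trans (+-homo (g zero) _) (+-congˡ (ι-∑ (λ i → g (suc i))))

    ι-× : ∀ n q → ι (n ×ℚ q) ≈ n × ι q
    ι-× zero    q = 0#-homo
    ι-× (suc n) q = trans (+-homo q (n ×ℚ q)) (+-congˡ (ι-× n q))

    ι-cancel : ∀ q .{{_ : ℚ.NonZero q}} x → ι q * x ≈ 0# → x ≈ 0#
    ι-cancel q x ιqx≈0 = begin
      x                       ≈⟨ *-identityˡ x ⟨
      1# * x                  ≈⟨ *-congʳ (trans (ι-≡ (ℚ.*-inverseˡ q)) 1#-homo) ⟨
      ι (ℚ.1/ q ℚ.* q) * x    ≈⟨ *-congʳ (*-homo (ℚ.1/ q) q) ⟩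
      ι (ℚ.1/ q) * ι q * x    ≈⟨ *-assoc _ _ x ⟩
      ι (ℚ.1/ q) * (ι q * x)  ≈⟨ *-congˡ ιqx≈0 ⟩
      ι (ℚ.1/ q) * 0#         ≈⟨ zeroʳ _ ⟩
      0#                      ∎

    noTorsion : ∀ n → NoTorsion (suc n)
    noTorsion n x n·x≈0 = ι-cancel n′ {{ℚ.pos⇒nonZero n′ {{×1ℚ-positive n}}}} x (begin
      ι (suc n ×ℚ 1ℚ) * x   ≈⟨ *-congʳ (trans (ι-× (suc n) 1ℚ) (×-congʳ (suc n) 1#-homo)) ⟩
      (suc n × 1#) * x      ≈⟨ ×-assoc-* (suc n) 1# x ⟩
      suc n × (1# * x)      ≈⟨ ×-congʳ (suc n) (*-identityˡ x) ⟩
      suc n × x             ≈⟨ n·x≈0 ⟩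
      0#                    ∎)
      where n′ = suc n ×ℚ 1ℚ

    gradFactorCoeff : (k a : ℕ) → Fin k → Carrier
    gradFactorCoeff k a r = ι (coeff (gradFactor k r) a)

    bernsteinCoeff : (K a : ℕ) → Fin K → Carrier
    bernsteinCoeff K a p = ι (bernstein (toℕ p) (K ∸ suc (toℕ p)) a)

    bernsteinCoeff-vanishesBelow : ∀ K p a → a < toℕ p → bernsteinCoeff K a p ≈ 0#
    bernsteinCoeff-vanishesBelow K p a a<p =
      trans (ι-≡ (bernstein-vanishesBelow (toℕ p) (K ∸ suc (toℕ p)) a a<p)) 0#-homo

    bernsteinCoeff-diag-cancel : ∀ K p y → bernsteinCoeff K (toℕ p) p * y ≈ 0# → y ≈ 0#
    bernsteinCoeff-diag-cancel K p = ι-cancel β {{ℚ.pos⇒nonZero β {{bernstein-diag-positive j l}}}}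
      where
      j = toℕ p
      l = K ∸ suc j
      β = bernstein j l j

    ∑-gradFactorCoeff-by-parts : ∀ K a (x : Fin (suc K) → Carrier) →
                                 ∑[ r < suc K ] (gradFactorCoeff (suc K) a r * x r) ≈
                                 ∑[ p < K ] (bernsteinCoeff K a p * Δ x p)
    ∑-gradFactorCoeff-by-parts K a x = begin
      ∑[ r < suc K ] (gradFactorCoeff (suc K) a r * x r)
        ≈⟨ sum-cong-≋ (λ r → *-congʳ {x = x r}
             (trans (ι-≡ (coeff-gradFactor (suc K) r a)) (ι[x-y]≈ιx-ιy (F⁺ r) (F⁻ r)))) ⟩
      ∑[ r < suc K ] ((ι (F⁺ r) - ι (F⁻ r)) * x r)
        ≈⟨ ∑-by-parts (ι ∘ F⁺) (ι ∘ F⁻) x (bernsteinCoeff K a)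
             (λ p → ι-≡ (gradFactor⁺-inject₁ K p a)) (trans (ι-≡ (gradFactor⁺-last K a)) 0#-homo)
             (trans (ι-≡ (gradFactor⁻-zero K a)) 0#-homo)
             (λ p → ι-≡ (gradFactor⁻-suc (toℕ p) (K ∸ suc (toℕ p)) a)) ⟩
      ∑[ p < K ] (bernsteinCoeff K a p * Δ x p)
        ∎
      where
      F⁺ F⁻ : Fin (suc K) → ℚ
      F⁺ r = gradFactor⁺ (toℕ r) (K ∸ toℕ r) a
      F⁻ r = gradFactor⁻ (toℕ r) (K ∸ toℕ r) a

    bilinearForm-gradFactorCoeff :
      ∀ K (M : Fin (suc K) → Fin (suc K) → Carrier) a b →
      bilinearForm M (gradFactorCoeff (suc K) a) (gradFactorCoeff (suc K) b) ≈
      ∑[ p < K ] (bernsteinCoeff K a p * ∑[ q < K ] (bernsteinCoeff K b q * Δ (λ s → Δ (λ r → M r s) p) q))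
    bilinearForm-gradFactorCoeff K M a b = trans
      (∑-gradFactorCoeff-by-parts K a (λ r → ∑[ s < suc K ] (φ s * M r s)))
      (sum-cong-≋ (λ p → *-congˡ (begin
        ∑[ s < suc K ] (φ s * M (inject₁ p) s) - ∑[ s < suc K ] (φ s * M (suc p) s)
          ≈⟨ ∑[f-g]≈∑f-∑g (λ s → φ s * M (inject₁ p) s) (λ s → φ s * M (suc p) s) ⟨
        ∑[ s < suc K ] (φ s * M (inject₁ p) s - φ s * M (suc p) s)
          ≈⟨ sum-cong-≋ (λ s → x[y-z]≈xy-xz (φ s) (M (inject₁ p) s) (M (suc p) s)) ⟨
        ∑[ s < suc K ] (φ s * Δ (λ r → M r s) p)
          ≈⟨ ∑-gradFactorCoeff-by-parts K b (λ s → Δ (λ r → M r s) p) ⟩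
        ∑[ q < K ] (bernsteinCoeff K b q * Δ (λ s → Δ (λ r → M r s) p) q)
          ∎)))
      where
      φ = gradFactorCoeff (suc K) b

    ι-gradCoeff : ∀ {k} (π : Permutation′ k) a b →
                  ι (gradCoeff k π a b) ≈
                  ι (ℤ.+ (k !) / 1) * ∑[ r < k ] (gradFactorCoeff k a r * gradFactorCoeff k b (π ⟨$⟩ʳ r))
    ι-gradCoeff {k} π a b =
      trans (*-homo _ _) (*-congˡ (trans (ι-∑ F) (sum-cong-≋ {k} (λ r → *-homo _ _))))
      where
      F : Fin k → ℚ
      F r = coeff (gradFactor k r) a ℚ.* coeff (gradFactor k (π ⟨$⟩ʳ r)) b

    combGradCoeff≈bilinearForm :
      ∀ {k m} (t : Fin m → Carrier) (π : Fin m → Permutation′ k) a b →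
      combGradCoeff R ι t π a b ≈
      ι (ℤ.+ (k !) / 1) * bilinearForm (coverMatrix R t π) (gradFactorCoeff k a) (gradFactorCoeff k b)
    combGradCoeff≈bilinearForm {k} {m} t π a b = begin
      combGradCoeff R ι t π a b
        ≡⟨ sumR≡sum (λ i → t i * ι (gradCoeff k (π i) a b)) ⟩
      ∑[ i < m ] (t i * ι (gradCoeff k (π i) a b))
        ≈⟨ sum-cong-≋ (λ i → *-congˡ (ι-gradCoeff (π i) a b)) ⟩
      ∑[ i < m ] (t i * (κ * ∑[ r < k ] (f r * g (π i ⟨$⟩ʳ r))))
        ≈⟨ *-distribˡ-∑-* κ t (λ i → ∑[ r < k ] (f r * g (π i ⟨$⟩ʳ r))) ⟨
      κ * ∑[ i < m ] (t i * ∑[ r < k ] (f r * g (π i ⟨$⟩ʳ r)))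
        ≈⟨ *-congˡ (sum-cong-≋ (λ i → *-congˡ (bilinearForm-permMatrix (π i) f g))) ⟨
      κ * ∑[ i < m ] (t i * bilinearForm (permMatrix R (π i)) f g)
        ≈⟨ *-congˡ (bilinearForm-∑ t (λ i → permMatrix R (π i)) f g) ⟨
      κ * bilinearForm (λ r s → ∑[ i < m ] (t i * permMatrix R (π i) r s)) f g
        ≈⟨ *-congˡ (bilinearForm-cong (coverMatrix≈∑ t π) f g) ⟨
      κ * bilinearForm (coverMatrix R t π) f g
        ∎
      where
      κ = ι (ℤ.+ (k !) / 1)
      f = gradFactorCoeff k a
      g = gradFactorCoeff k b

    combGradCoeff≈0⇒bilinearForm≈0 :
      ∀ {k m} (t : Fin m → Carrier) (π : Fin m → Permutation′ k) a b → combGradCoeff R ι t π a b ≈ 0# →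
      bilinearForm (coverMatrix R t π) (gradFactorCoeff k a) (gradFactorCoeff k b) ≈ 0#
    combGradCoeff≈0⇒bilinearForm≈0 {k} t π a b ω≈0 =
      ι-cancel k! {{ℚ.pos⇒nonZero k! {{ℚ.normalize-pos (k !) 1 {{_}} {{k !≢0}}}}}} _
        (trans (sym (combGradCoeff≈bilinearForm t π a b)) ω≈0)
      where k! = ℤ.+ (k !) / 1

    bernsteinCoeff-independent : ∀ K (z : Fin K → Carrier) →
                                 (∀ a → ∑[ p < K ] (bernsteinCoeff K a p * z p) ≈ 0#) → ∀ p → z p ≈ 0#
    bernsteinCoeff-independent K z =
      triangular⇒trivial (λ p a → bernsteinCoeff K a p) z
        (bernsteinCoeff-vanishesBelow K) (bernsteinCoeff-diag-cancel K)

lemma9 : {c ℓ : Level} (R : CommutativeRing c ℓ) (ι : ℚ → CommutativeRing.Carrier R) →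
    IsℚEmbedding R ι →
    (k m : ℕ) (t : Fin m → CommutativeRing.Carrier R) (π : Fin m → Permutation′ k) →
    (∀ (a b : ℕ) → CommutativeRing._≈_ R (combGradCoeff R ι t π a b) (CommutativeRing.0# R)) →
    ∀ (r s r′ s′ : Fin k) →
    CommutativeRing._≈_ R (coverMatrix R t π r s) (coverMatrix R t π r′ s′)
lemma9 R ι ι-hom zero    m t π ω≈0 ()
lemma9 R ι ι-hom (suc K) m t π ω≈0 r s r′ s′ = trans (C≈C₀₀ r s) (sym (C≈C₀₀ r′ s′))
  where
  open CommutativeRing R using (_≈_; 0#; sym; trans)
  C = coverMatrix R t π

  Δ²C≈0 : ∀ p q → Δ R (λ s → Δ R (λ r → C r s) p) q ≈ 0#
  Δ²C≈0 p = bernsteinCoeff-independent R ι ι-hom K _ (λ b →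
    bernsteinCoeff-independent R ι ι-hom K _ (λ a →
      trans (sym (bilinearForm-gradFactorCoeff R ι ι-hom K C a b))
            (combGradCoeff≈0⇒bilinearForm≈0 R ι ι-hom t π a b (ω≈0 a b))) p)

  C≈C₀₀ : ∀ r s → C r s ≈ C zero zero
  C≈C₀₀ = separable⇒constant R C (noTorsion R ι ι-hom K) (Δ²≈0⇒separable R C Δ²C≈0)
    (λ r → trans (∑-coverMatrix-row R t π r) (sym (∑-coverMatrix-row R t π zero)))
    (λ s → trans (∑-coverMatrix-column R t π s) (sym (∑-coverMatrix-column R t π zero)))
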